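{- Let $r\ge2$ and $A=\{a_1<\dots<a_r\}\in\binom{[n]}{r}$, and let $\mathcal{A}=F(r,n,\{A\})$. Writing $f_{a_1,\dots,a_r}=f_{\mathcal{A}}$, we have $$f_{a_1,\dots,a_r}(x_1,\dots,x_n)=\sum_{i=r}^{a_r}x_i\,f_{\{\min\{a_j,i+j-r\}\}_{j=1}^{r-1}}(x_1,\dots,x_{n-1}),$$ where $\{\min\{a_j,i+j-r\}\}_{j=1}^{r-1}$ denotes the $(r-1)$-element set whose $j$-th smallest element is $\min\{a_j,i+j-r\}$, and $f_{\{c_1,\dots,c_{r-1}\}}(x_1,\dots,x_{n-1})$ denotes $f_{\mathcal{C}}$ for $\mathcal{C}=F(r-1,n-1,\{\{c_1,\dots,c_{r-1}\}\})$.
   Context: $[n]=\{1,\dots,n\}$; $\binom{[n]}{r}$ is the set of $r$-subsets of $[n]$ listed increasingly. For $B=\{b_1<\dots<b_r\}$ and $C=\{c_1<\dots<c_k\}$, $B\prec C$ means $r\ge k$ and $b_i\le c_i$ for $1\le i\le k$. For $\mathcal{G}\subseteq2^{[n]}$, $F(r,n,\mathcal{G})=\{B\in\binom{[n]}{r}:B\prec G\text{ for some }G\in\mathcal{G}\}$. For a family $\mathcal{A}\subseteq\binom{[n]}{r}$, $f_{\mathcal{A}}(x_1,\dots,x_n)=\sum_{B\in\mathcal{A}}\prod_{i\in B}x_i$ (a polynomial in $x_1,\dots,x_n$). -}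

module Defs where

open import Level using (Level)
open import Data.Nat using (ℕ; zero; suc; _+_; _∸_; _≤_; _≤?_; _⊓_; z≤n; s≤s)
open import Data.List using (List; []; _∷_; [_]; _++_; map; filter; foldr; applyUpTo; _∷ʳ_)
open import Relation.Nullary using (Dec; yes; no)
open import Relation.Binary using (Decidable)
open import Algebra.Bundles using (CommutativeSemiring)

-- Finite sets are represented by increasingly listed lists of naturals.

-- binom([n], r): all r-subsets of [n] = {1,…,n}, each listed increasingly.
subsets : ℕ → ℕ → List (List ℕ)
subsets zero    n       = [ [] ]
subsets (suc r) zero    = []
subsets (suc r) (suc n) = subsets (suc r) n ++ map (_∷ʳ suc n) (subsets r n)

data _≺_ : List ℕ → List ℕ → Set where
  ≺-[] : ∀ {B} → B ≺ []
  ≺-∷  : ∀ {b c B C} → b ≤ c → B ≺ C → (b ∷ B) ≺ (c ∷ C)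

_≺?_ : Decidable _≺_
B ≺? [] = yes ≺-[]
[] ≺? (c ∷ C) = no (λ ())
(b ∷ B) ≺? (c ∷ C) with b ≤? c | B ≺? C
... | yes p | yes q = yes (≺-∷ p q)
... | no ¬p | _     = no λ { (≺-∷ p _) → ¬p p }
... | yes _ | no ¬q = no λ { (≺-∷ _ q) → ¬q q }

F₁ : ℕ → ℕ → List ℕ → List (List ℕ)
F₁ r n G = filter (_≺? G) (subsets r n)

-- j-th element (0-based) of a list, default 0
nth : ℕ → List ℕ → ℕ
nth k       []      = 0
nth zero    (a ∷ A) = a
nth (suc k) (a ∷ A) = nth k A

-- [m, M] = {m, m+1, …, M} as a list (empty if M < m)
interval : ℕ → ℕ → List ℕ
interval m M = applyUpTo (m +_) (suc M ∸ m)

module _ {c ℓ : Level} (R : CommutativeSemiring c ℓ) where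
  open CommutativeSemiring R using (Carrier; 0#; 1#) renaming (_+_ to _+R_; _*_ to _*R_)

  sumR : List Carrier → Carrier
  sumR = foldr _+R_ 0#

  prodR : List Carrier → Carrier
  prodR = foldr _*R_ 1#

  fam-poly : List (List ℕ) → (ℕ → Carrier) → Carrier
  fam-poly 𝒜 x = sumR (map (λ B → prodR (map x B)) 𝒜)

innerSet : ℕ → ℕ → List ℕ → List ℕ
innerSet r i A = applyUpTo (λ k → nth k A ⊓ (i + suc k ∸ r)) (r ∸ 1)

-- An r-set B ≺ A = A' ∪ {a} with a = max A has max B = i ≤ a, and then B ∖ {i} ≺ A'
-- is an (r-1)-subset of [i-1].  Grouping F(r,n,A) by the largest element i factors
-- x_i out of each group.  Inside [i-1] every (r-1)-set lies below the largest one,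
-- {i-r+1,…,i-1}, so ≺ A' may be replaced by ≺ the pointwise minimum of A' with that
-- set, which is exactly the set {min{a_j, i+j-r}}; this set lies inside [i-1], so the
-- ground set [i-1] may be enlarged to [n-1].
module Submission where

open import Defs
open import Level using (Level)
open import Data.Nat using (ℕ; zero; suc; _+_; _∸_; _≤_; _<_; _≤?_; _⊓_; _≤′_; z≤n; s≤s; ≤′-reflexive; ≤′-step)
open import Data.Nat.Properties
  using (suc-injective; ≤-refl; ≤-trans; ≤-pred; ≤-reflexive; <⇒≤; <⇒≱; ≰⇒>; n≤1+n; m≤n⇒m≤1+n; m≤m+n
        ; ≤⇒≤′; ≤′⇒≤; +-comm; +-suc; +-monoʳ-≤; ∸-monoˡ-≤; +-∸-assoc; m+n∸n≡m; m+[n∸m]≡n; m≤n⇒m∸n≡0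
        ; ⊓-glb; ⊓-idem; m⊓n≤m; m⊓n≤n)
open import Data.List using (List; []; _∷_; [_]; _++_; map; filter; concatMap; applyUpTo; zipWith; _∷ʳ_; length)
open import Data.List.Properties using (filter-++; filter-accept; filter-reject; filter-none; concatMap-++; applyUpTo-∷ʳ; length-applyUpTo; length-++; length-zipWith; ++-identityʳ)
open import Data.List.Membership.Propositional using (_∈_)
open import Data.List.Membership.Propositional.Properties using (∈-++⁻; ∈-map⁻; ∈-applyUpTo⁻)
open import Data.List.Relation.Unary.All as All using (All; []; _∷_)
open import Data.List.Relation.Unary.All.Properties using (∷ʳ⁺; ∷ʳ⁻; applyUpTo⁺₁)
open import Data.List.Relation.Unary.Any using (here; there)
open import Data.Product using (∃₂; _×_; _,_; proj₁; proj₂)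
open import Data.Sum using (inj₁; inj₂)
open import Data.Bool using (true; false)
open import Function using (_∘_)
open import Relation.Nullary using (¬_; yes; no; does; contradiction)
open import Relation.Unary using (Pred; Decidable)
open import Relation.Binary.PropositionalEquality using (_≡_; refl; sym; trans; cong; cong₂; subst; module ≡-Reasoning)
import Relation.Binary.Reasoning.Setoid as SetoidReasoning
open import Algebra.Bundles using (CommutativeSemiring)

filter-map : ∀ {a b p} {A : Set a} {B : Set b} {P : Pred B p} (P? : Decidable P) (f : A → B) (xs : List A) →
             filter P? (map f xs) ≡ map f (filter (P? ∘ f) xs)
filter-map P? f [] = refl
filter-map P? f (x ∷ xs) with does (P? (f x))
... | true  = cong (f x ∷_) (filter-map P? f xs)
... | false = filter-map P? f xs

module _ {b p q} {B : Set b} {P : Pred B p} {Q : Pred B q} where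

  filter-cong-All : (P? : Decidable P) (Q? : Decidable Q) {xs : List B} →
                    All (λ x → (P x → Q x) × (Q x → P x)) xs → filter P? xs ≡ filter Q? xs
  filter-cong-All P? Q? {[]} [] = refl
  filter-cong-All P? Q? {x ∷ xs} ((to , from) ∷ eqs) with P? x
  ... | yes px = trans (cong (x ∷_) (filter-cong-All P? Q? eqs)) (sym (filter-accept Q? (to px)))
  ... | no ¬px = trans (filter-cong-All P? Q? eqs) (sym (filter-reject Q? (¬px ∘ from)))

length-∷ʳ : ∀ {a} {A : Set a} (xs : List A) x → length (xs ∷ʳ x) ≡ suc (length xs)
length-∷ʳ xs x = trans (length-++ xs) (+-comm (length xs) 1)

<∸⇒+< : ∀ m {n o} → n < o ∸ m → m + n < o
<∸⇒+< zero    n<o   = n<o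
<∸⇒+< (suc m) {o = suc o} n<o = s≤s (<∸⇒+< m n<o)

interval-∷ʳ : ∀ {m n} → m ≤ suc n → interval m (suc n) ≡ interval m n ∷ʳ suc n
interval-∷ʳ {m} {n} m≤1+n = begin
  applyUpTo (m +_) (suc (suc n) ∸ m)          ≡⟨ cong (applyUpTo (m +_)) (+-∸-assoc 1 m≤1+n) ⟩
  applyUpTo (m +_) (suc (suc n ∸ m))          ≡⟨ sym (applyUpTo-∷ʳ (m +_) (suc n ∸ m)) ⟩
  interval m n ∷ʳ (m + (suc n ∸ m))           ≡⟨ cong (interval m n ∷ʳ_) (m+[n∸m]≡n m≤1+n) ⟩
  interval m n ∷ʳ suc n                       ∎
  where open ≡-Reasoning

∈-interval⁻ : ∀ {m M i} → i ∈ interval m M → m ≤ i × i ≤ M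
∈-interval⁻ {m} {M} i∈ with k , k< , refl ← ∈-applyUpTo⁻ (m +_) i∈ =
  m≤m+n m k , ≤-pred (<∸⇒+< m k<)

nth-∷ʳ-length : ∀ (A : List ℕ) a → nth (length A) (A ∷ʳ a) ≡ a
nth-∷ʳ-length []      a = refl
nth-∷ʳ-length (_ ∷ A) a = nth-∷ʳ-length A a

applyUpTo-nth-++ : ∀ (_∙_ : ℕ → ℕ → ℕ) (L M : List ℕ) (g : ℕ → ℕ) →
  applyUpTo (λ k → nth k (L ++ M) ∙ g k) (length L) ≡ zipWith _∙_ L (applyUpTo g (length L))
applyUpTo-nth-++ _∙_ []      M g = refl
applyUpTo-nth-++ _∙_ (l ∷ L) M g = cong (l ∙ g 0 ∷_) (applyUpTo-nth-++ _∙_ L M (g ∘ suc))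

≺-refl : ∀ B → B ≺ B
≺-refl []      = ≺-[]
≺-refl (b ∷ B) = ≺-∷ ≤-refl (≺-refl B)

≺-trans : ∀ {B C D} → B ≺ C → C ≺ D → B ≺ D
≺-trans _               ≺-[]            = ≺-[]
≺-trans (≺-∷ b≤c B≺C) (≺-∷ c≤d C≺D) = ≺-∷ (≤-trans b≤c c≤d) (≺-trans B≺C C≺D)

≺-∷ʳ⁺ : ∀ {B C b c} → length B ≡ length C → B ≺ C → b ≤ c → (B ∷ʳ b) ≺ (C ∷ʳ c)
≺-∷ʳ⁺ {[]}    {[]}    _   _              b≤c = ≺-∷ b≤c ≺-[]
≺-∷ʳ⁺ {_ ∷ _} {_ ∷ _} len (≺-∷ b≤c B≺C) b≤c′ = ≺-∷ b≤c (≺-∷ʳ⁺ (suc-injective len) B≺C b≤c′)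

≺-∷ʳ⁻ : ∀ {B C b c} → length B ≡ length C → (B ∷ʳ b) ≺ (C ∷ʳ c) → B ≺ C × b ≤ c
≺-∷ʳ⁻ {[]}    {[]}    _   (≺-∷ b≤c _)   = ≺-[] , b≤c
≺-∷ʳ⁻ {_ ∷ _} {_ ∷ _} len (≺-∷ b≤c B≺C) with ≺-∷ʳ⁻ (suc-injective len) B≺C
... | B≺C′ , b≤c′ = ≺-∷ b≤c B≺C′ , b≤c′

≺-All-≤ : ∀ {m B C} → length B ≡ length C → B ≺ C → All (_≤ m) C → All (_≤ m) B
≺-All-≤ {B = []}    _   _              _            = []
≺-All-≤ {B = _ ∷ _} ()  ≺-[]           _
≺-All-≤ {B = _ ∷ _} len (≺-∷ b≤c B≺C) (c≤m ∷ C≤m) = ≤-trans b≤c c≤m ∷ ≺-All-≤ (suc-injective len) B≺C C≤m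

≺-zipWith-⊓⁺ : ∀ {B C D} → B ≺ C → B ≺ D → B ≺ zipWith _⊓_ C D
≺-zipWith-⊓⁺ ≺-[]            _               = ≺-[]
≺-zipWith-⊓⁺ (≺-∷ _ _)       ≺-[]            = ≺-[]
≺-zipWith-⊓⁺ (≺-∷ b≤c B≺C) (≺-∷ b≤d B≺D) = ≺-∷ (⊓-glb b≤c b≤d) (≺-zipWith-⊓⁺ B≺C B≺D)

≺-zipWith-⊓⁻ : ∀ {B C D} → length C ≡ length D → B ≺ zipWith _⊓_ C D → B ≺ C × B ≺ D
≺-zipWith-⊓⁻ {C = []}    {[]}    _   _                = ≺-[] , ≺-[]
≺-zipWith-⊓⁻ {C = c ∷ _} {d ∷ _} len (≺-∷ b≤c⊓d B≺) with ≺-zipWith-⊓⁻ (suc-injective len) B≺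
... | B≺C , B≺D = ≺-∷ (≤-trans b≤c⊓d (m⊓n≤m c d)) B≺C , ≺-∷ (≤-trans b≤c⊓d (m⊓n≤n c d)) B≺D

applyUpTo-≺ : ∀ {f g} n → (∀ k → f k ≤ g k) → applyUpTo f n ≺ applyUpTo g n
applyUpTo-≺ zero    f≤g = ≺-[]
applyUpTo-≺ (suc n) f≤g = ≺-∷ (f≤g 0) (applyUpTo-≺ n (f≤g ∘ suc))

topSubset : ℕ → ℕ → List ℕ
topSubset r m = applyUpTo (λ k → m + suc k ∸ r) r

topSubset-≤ : ∀ r m → All (_≤ m) (topSubset r m)
topSubset-≤ r m = applyUpTo⁺₁ _ r λ {k} k<r →
  ≤-trans (∸-monoˡ-≤ r (+-monoʳ-≤ m k<r)) (≤-reflexive (m+n∸n≡m m r))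

topSubset-∷ʳ : ∀ r m → topSubset (suc r) (suc m) ≡ topSubset r m ∷ʳ suc m
topSubset-∷ʳ r m = trans (sym (applyUpTo-∷ʳ _ r))
  (cong (topSubset r m ∷ʳ_) (trans (cong (_∸ r) (+-suc m r)) (m+n∸n≡m (suc m) r)))

∈-subsets⇒length : ∀ r m {B} → B ∈ subsets r m → length B ≡ r
∈-subsets⇒length zero    m       (here refl) = refl
∈-subsets⇒length (suc r) (suc m) B∈ with ∈-++⁻ (subsets (suc r) m) B∈
... | inj₁ B∈′ = ∈-subsets⇒length (suc r) m B∈′
... | inj₂ B∈′ with B′ , B′∈ , refl ← ∈-map⁻ (_∷ʳ suc m) B∈′ =
  trans (length-∷ʳ B′ (suc m)) (cong suc (∈-subsets⇒length r m B′∈))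

∈-subsets⇒≺-topSubset : ∀ r m {B} → B ∈ subsets r m → B ≺ topSubset r m
∈-subsets⇒≺-topSubset zero    m       _  = ≺-[]
∈-subsets⇒≺-topSubset (suc r) (suc m) B∈ with ∈-++⁻ (subsets (suc r) m) B∈
... | inj₁ B∈′ = ≺-trans (∈-subsets⇒≺-topSubset (suc r) m B∈′)
                         (applyUpTo-≺ (suc r) λ k → ∸-monoˡ-≤ (suc r) (n≤1+n (m + suc k)))
... | inj₂ B∈′ with B′ , B′∈ , refl ← ∈-map⁻ (_∷ʳ suc m) B∈′ =
  subst ((B′ ∷ʳ suc m) ≺_) (sym (topSubset-∷ʳ r m))
    (≺-∷ʳ⁺ (trans (∈-subsets⇒length r m B′∈) (sym (length-applyUpTo _ r)))
           (∈-subsets⇒≺-topSubset r m B′∈) ≤-refl)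

∈-subsets⇒All-≤ : ∀ r m {B} → B ∈ subsets r m → All (_≤ m) B
∈-subsets⇒All-≤ r m B∈ =
  ≺-All-≤ (trans (∈-subsets⇒length r m B∈) (sym (length-applyUpTo _ r)))
          (∈-subsets⇒≺-topSubset r m B∈) (topSubset-≤ r m)

∈-subsets-∷ʳ⁻ : ∀ {r n A} → A ∈ subsets (suc r) n →
  ∃₂ λ A′ m → A ≡ A′ ∷ʳ suc m × A′ ∈ subsets r m × suc m ≤ n
∈-subsets-∷ʳ⁻ {r} {suc n} A∈ with ∈-++⁻ (subsets (suc r) n) A∈
... | inj₁ A∈′ with A′ , m , eq , A′∈ , m<n ← ∈-subsets-∷ʳ⁻ A∈′ = A′ , m , eq , A′∈ , m≤n⇒m≤1+n m<n
... | inj₂ A∈′ with A′ , A′∈ , eq ← ∈-map⁻ (_∷ʳ suc n) A∈′ = A′ , n , eq , A′∈ , ≤-refl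

subsets-< : ∀ {r m} → m < r → subsets r m ≡ []
subsets-< {suc r} {zero}  _         = refl
subsets-< {suc r} {suc m} (s≤s m<r)
  rewrite subsets-< {suc r} {m} (m≤n⇒m≤1+n m<r) | subsets-< m<r = refl

F₁-truncate : ∀ {r m N C} → length C ≡ r → All (_≤ m) C → m ≤ N → F₁ r N C ≡ F₁ r m C
F₁-truncate {zero}          _   _   _   = refl
F₁-truncate {suc r} {m} {C = C} len C≤m m≤N = go (≤⇒≤′ m≤N)
  where
  open ≡-Reasoning
  go : ∀ {N} → m ≤′ N → F₁ (suc r) N C ≡ F₁ (suc r) m C
  go (≤′-reflexive refl) = refl
  go (≤′-step {N} m≤′N) = begin
    F₁ (suc r) (suc N) C
      ≡⟨ filter-++ (_≺? C) (subsets (suc r) N) (map (_∷ʳ suc N) (subsets r N)) ⟩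
    F₁ (suc r) N C ++ filter (_≺? C) (map (_∷ʳ suc N) (subsets r N))
      ≡⟨ cong (F₁ (suc r) N C ++_) (filter-none (_≺? C) (All.tabulate too-large)) ⟩
    F₁ (suc r) N C ++ []   ≡⟨ ++-identityʳ _ ⟩
    F₁ (suc r) N C         ≡⟨ go m≤′N ⟩
    F₁ (suc r) m C         ∎
    where
    too-large : ∀ {B} → B ∈ map (_∷ʳ suc N) (subsets r N) → ¬ B ≺ C
    too-large B∈ B≺C with B′ , B′∈ , refl ← ∈-map⁻ (_∷ʳ suc N) B∈ =
      let lenB = trans (length-∷ʳ B′ (suc N)) (trans (cong suc (∈-subsets⇒length r N B′∈)) (sym len))
      in <⇒≱ (s≤s (≤′⇒≤ m≤′N)) (proj₂ (∷ʳ⁻ (≺-All-≤ lenB B≺C C≤m)))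

F₁-∷ʳ-map : ∀ {r m s a A′} → length A′ ≡ r → s ≤ a →
  filter (_≺? (A′ ∷ʳ a)) (map (_∷ʳ s) (subsets r m)) ≡ map (_∷ʳ s) (F₁ r m A′)
F₁-∷ʳ-map {r} {m} {s} {a} {A′} len s≤a =
  trans (filter-map (_≺? (A′ ∷ʳ a)) (_∷ʳ s) (subsets r m))
        (cong (map (_∷ʳ s)) (filter-cong-All _ (_≺? A′) (All.tabulate same)))
  where
  same : ∀ {B} → B ∈ subsets r m → ((B ∷ʳ s) ≺ (A′ ∷ʳ a) → B ≺ A′) × (B ≺ A′ → (B ∷ʳ s) ≺ (A′ ∷ʳ a))
  same {B} B∈ = (λ p → proj₁ (≺-∷ʳ⁻ lenB p)) , (λ p → ≺-∷ʳ⁺ lenB p s≤a)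
    where
    lenB : length B ≡ length A′
    lenB = trans (∈-subsets⇒length r m B∈) (sym len)

F₁-∷ʳ : ∀ {r m a A′} → length A′ ≡ r → m ≤ a →
  F₁ (suc r) m (A′ ∷ʳ a) ≡ concatMap (λ i → map (_∷ʳ i) (F₁ r (i ∸ 1) A′)) (interval (suc r) m)
F₁-∷ʳ {r} {m} len m≤a with m ≤? r
... | yes m≤r rewrite subsets-< (s≤s m≤r) | m≤n⇒m∸n≡0 m≤r = refl
F₁-∷ʳ {r} {zero}   _   _   | no m≰r = contradiction z≤n m≰r
F₁-∷ʳ {r} {suc m} {a} {A′} len m<a | no m≰r = begin
  F₁ (suc r) (suc m) (A′ ∷ʳ a)
    ≡⟨ filter-++ (_≺? (A′ ∷ʳ a)) (subsets (suc r) m) (map (_∷ʳ suc m) (subsets r m)) ⟩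
  F₁ (suc r) m (A′ ∷ʳ a) ++ filter (_≺? (A′ ∷ʳ a)) (map (_∷ʳ suc m) (subsets r m))
    ≡⟨ cong₂ _++_ (F₁-∷ʳ len (<⇒≤ m<a)) (F₁-∷ʳ-map len m<a) ⟩
  concatMap 𝒢 (interval (suc r) m) ++ 𝒢 (suc m)
    ≡⟨ cong (concatMap 𝒢 (interval (suc r) m) ++_) (sym (++-identityʳ (𝒢 (suc m)))) ⟩
  concatMap 𝒢 (interval (suc r) m) ++ concatMap 𝒢 [ suc m ]
    ≡⟨ sym (concatMap-++ 𝒢 (interval (suc r) m) [ suc m ]) ⟩
  concatMap 𝒢 (interval (suc r) m ∷ʳ suc m)
    ≡⟨ cong (concatMap 𝒢) (sym (interval-∷ʳ (≰⇒> m≰r))) ⟩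
  concatMap 𝒢 (interval (suc r) (suc m))
    ∎
  where
  open ≡-Reasoning
  𝒢 : ℕ → List (List ℕ)
  𝒢 i = map (_∷ʳ i) (F₁ r (i ∸ 1) A′)

innerSet-∷ʳ : ∀ (A′ : List ℕ) a m →
  innerSet (suc (length A′)) (suc m) (A′ ∷ʳ a) ≡ zipWith _⊓_ A′ (topSubset (length A′) m)
innerSet-∷ʳ A′ a m = applyUpTo-nth-++ _⊓_ A′ [ a ] (λ k → m + suc k ∸ length A′)

F₁-innerSet : ∀ {r m N a A′} → length A′ ≡ r → m ≤ N →
  F₁ r N (innerSet (suc r) (suc m) (A′ ∷ʳ a)) ≡ F₁ r m A′
F₁-innerSet {m = m} {N} {a} {A′} refl m≤N = begin
  F₁ r N (innerSet (suc r) (suc m) (A′ ∷ʳ a))  ≡⟨ cong (F₁ r N) (innerSet-∷ʳ A′ a m) ⟩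
  F₁ r N C                                     ≡⟨ F₁-truncate lenC C≤m m≤N ⟩
  F₁ r m C                                     ≡⟨ filter-cong-All (_≺? C) (_≺? A′) (All.tabulate same) ⟩
  F₁ r m A′                                    ∎
  where
  open ≡-Reasoning
  r : ℕ
  r = length A′
  T C : List ℕ
  T = topSubset r m
  C = zipWith _⊓_ A′ T
  lenA′ : r ≡ length T
  lenA′ = sym (length-applyUpTo _ r)
  lenC : length C ≡ r
  lenC = trans (length-zipWith _⊓_ A′ T) (trans (cong (r ⊓_) (sym lenA′)) (⊓-idem r))
  C≤m : All (_≤ m) C
  C≤m = ≺-All-≤ (trans lenC lenA′) (proj₂ (≺-zipWith-⊓⁻ lenA′ (≺-refl C))) (topSubset-≤ r m)
  same : ∀ {B} → B ∈ subsets r m → (B ≺ C → B ≺ A′) × (B ≺ A′ → B ≺ C)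
  same B∈ = (proj₁ ∘ ≺-zipWith-⊓⁻ lenA′) , (λ B≺A′ → ≺-zipWith-⊓⁺ B≺A′ (∈-subsets⇒≺-topSubset r m B∈))

module _ {c ℓ} (R : CommutativeSemiring c ℓ) where
  open CommutativeSemiring R
    using (Carrier; _≈_; 0#; +-congˡ; +-cong; +-identityˡ; +-assoc; *-congˡ; *-assoc; *-comm; distribˡ; zeroʳ)
    renaming (_+_ to _+R_; _*_ to _*R_; sym to ≈-sym; trans to ≈-trans; refl to ≈-refl)

  sumR-map-cong : ∀ {a} {A : Set a} {f g : A → Carrier} (xs : List A) →
                  (∀ {i} → i ∈ xs → f i ≈ g i) → sumR R (map f xs) ≈ sumR R (map g xs)
  sumR-map-cong []       f≈g = ≈-refl
  sumR-map-cong (i ∷ xs) f≈g = +-cong (f≈g (here refl)) (sumR-map-cong xs (f≈g ∘ there))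

  fam-poly-++ : ∀ 𝒜 ℬ x → fam-poly R (𝒜 ++ ℬ) x ≈ fam-poly R 𝒜 x +R fam-poly R ℬ x
  fam-poly-++ []      ℬ x = ≈-sym (+-identityˡ _)
  fam-poly-++ (B ∷ 𝒜) ℬ x = ≈-trans (+-congˡ (fam-poly-++ 𝒜 ℬ x)) (≈-sym (+-assoc _ _ _))

  prodR-∷ʳ : ∀ (x : ℕ → Carrier) B i → prodR R (map x (B ∷ʳ i)) ≈ prodR R (map x B) *R x i
  prodR-∷ʳ x []      i = *-comm _ _
  prodR-∷ʳ x (b ∷ B) i = ≈-trans (*-congˡ (prodR-∷ʳ x B i)) (≈-sym (*-assoc _ _ _))

  fam-poly-map-∷ʳ : ∀ x i 𝒜 → fam-poly R (map (_∷ʳ i) 𝒜) x ≈ x i *R fam-poly R 𝒜 x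
  fam-poly-map-∷ʳ x i []      = ≈-sym (zeroʳ _)
  fam-poly-map-∷ʳ x i (B ∷ 𝒜) =
    ≈-trans (+-cong (≈-trans (prodR-∷ʳ x B i) (*-comm _ _)) (fam-poly-map-∷ʳ x i 𝒜))
            (≈-sym (distribˡ _ _ _))

  fam-poly-concatMap-∷ʳ : ∀ x (𝒜 : ℕ → List (List ℕ)) is →
    fam-poly R (concatMap (λ i → map (_∷ʳ i) (𝒜 i)) is) x ≈ sumR R (map (λ i → x i *R fam-poly R (𝒜 i) x) is)
  fam-poly-concatMap-∷ʳ x 𝒜 []       = ≈-refl
  fam-poly-concatMap-∷ʳ x 𝒜 (i ∷ is) =
    ≈-trans (fam-poly-++ (map (_∷ʳ i) (𝒜 i)) _ x)
            (+-cong (fam-poly-map-∷ʳ x i (𝒜 i)) (fam-poly-concatMap-∷ʳ x 𝒜 is))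

proposition21 : ∀ {c ℓ : Level} (R : CommutativeSemiring c ℓ) (r n : ℕ) (A : List ℕ) →
    2 ≤ r → A ∈ subsets r n → (x : ℕ → CommutativeSemiring.Carrier R) →
    CommutativeSemiring._≈_ R
      (fam-poly R (F₁ r n A) x)
      (sumR R (map (λ i → CommutativeSemiring._*_ R (x i)
                            (fam-poly R (F₁ (r ∸ 1) (n ∸ 1) (innerSet r i A)) x))
                   (interval r (nth (r ∸ 1) A))))
proposition21 R r@(suc r′) n A (s≤s (s≤s _)) A∈ x
  with A′ , m , refl , A′∈ , a≤n ← ∈-subsets-∷ʳ⁻ A∈ = begin
    fam-poly R (F₁ r n A) x
      ≡⟨ cong (λ 𝒜 → fam-poly R 𝒜 x) (trans (F₁-truncate {N = n} lenA A≤a a≤n) (F₁-∷ʳ {m = a} lenA′ ≤-refl)) ⟩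
    fam-poly R (concatMap (λ i → map (_∷ʳ i) (F₁ r′ (i ∸ 1) A′)) (interval r a)) x
      ≈⟨ fam-poly-concatMap-∷ʳ R x (λ i → F₁ r′ (i ∸ 1) A′) (interval r a) ⟩
    sumR R (map (λ i → x i * fam-poly R (F₁ r′ (i ∸ 1) A′) x) (interval r a))
      ≈⟨ sumR-map-cong R (interval r a) (λ i∈ → *-congˡ (reflexive (cong (λ 𝒜 → fam-poly R 𝒜 x) (inner i∈)))) ⟩
    sumR R (map term (interval r a))
      ≡⟨ cong (λ M → sumR R (map term (interval r M))) (sym (subst (λ k → nth k A ≡ a) lenA′ (nth-∷ʳ-length A′ a))) ⟩
    sumR R (map term (interval r (nth r′ A)))
      ∎
  where
  open CommutativeSemiring R using (Carrier; _*_; *-congˡ; reflexive; setoid)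
  open SetoidReasoning setoid
  a : ℕ
  a = suc m
  term : ℕ → Carrier
  term i = x i * fam-poly R (F₁ r′ (n ∸ 1) (innerSet r i A)) x
  lenA′ : length A′ ≡ r′
  lenA′ = ∈-subsets⇒length r′ m A′∈
  lenA : length A ≡ r
  lenA = trans (length-∷ʳ A′ a) (cong suc lenA′)
  A≤a : All (_≤ a) A
  A≤a = ∷ʳ⁺ (All.map m≤n⇒m≤1+n (∈-subsets⇒All-≤ r′ m A′∈)) ≤-refl
  inner : ∀ {i} → i ∈ interval r a → F₁ r′ (i ∸ 1) A′ ≡ F₁ r′ (n ∸ 1) (innerSet r i A)
  inner i∈ with ∈-interval⁻ {r} {a} i∈
  ... | s≤s _ , i≤a = sym (F₁-innerSet lenA′ (∸-monoˡ-≤ 1 (≤-trans i≤a a≤n)))
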